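{- For every integer $a\ge 2$, $$ s(a,a+2,a+3,a+4)=\begin{cases} \dfrac{(a+4)(a^3+4 a^2+22 a+24)}{96}&\text{if } a\equiv 0\pmod 4,\\ \dfrac{(a+3)(a^3+5 a^2+8 a+34)}{96}&\text{if } a\equiv 1\pmod 4,\\ \dfrac{(a+2)(a^3+6 a^2+14 a+36)}{96}&\text{if } a\equiv 2\pmod 4,\\ \dfrac{(a+5)(a^3+3 a^2+8 a+6)}{96}&\text{if } a\equiv 3\pmod 4. \end{cases} $$
   Context: For positive integers $a_1,\dots,a_m$ with $\gcd(a_1,\dots,a_m)=1$, the Sylvester sum $s(a_1,\dots,a_m)$ is the sum of all positive integers that cannot be written as $x_1a_1+\cdots+x_ma_m$ with nonnegative integers $x_i$. -}

module Defs where

open import Data.Nat using (ℕ; zero; suc; _+_; _*_; _<_)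
open import Data.List using (List)
open import Data.Nat.ListAction using (sum)
open import Data.Vec using (Vec; []; _∷_)
open import Data.Product using (Σ; ∃; _×_; _,_)
open import Data.Empty using (⊥)
open import Relation.Nullary using (¬_)
open import Relation.Binary.PropositionalEquality using (_≡_)
open import Data.List.Membership.Propositional using (_∈_)
open import Data.List.Relation.Unary.Unique.Propositional using (Unique)
open import Function.Bundles using (_⇔_)

lincomb : ∀ {m} → Vec ℕ m → Vec ℕ m → ℕ
lincomb [] [] = 0
lincomb (x ∷ xs) (a ∷ as) = x * a + lincomb xs as

Representable : ∀ {m} → Vec ℕ m → ℕ → Set
Representable {m} as n = Σ (Vec ℕ m) λ xs → lincomb xs as ≡ n

Gap : ∀ {m} → Vec ℕ m → ℕ → Set
Gap as n = (0 < n) × ¬ Representable as n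

IsSylvesterSum : ∀ {m} → Vec ℕ m → ℕ → Set
IsSylvesterSum as S =
  Σ (List ℕ) λ L → Unique L × (∀ n → (n ∈ L) ⇔ Gap as n) × (sum L ≡ S)

-- A sum of k of the generators a, a + 2, a + 3, a + 4 is k a + t, where the total offset t can
-- be 0 or anything from 2 to 4 k. Writing n = q a + r with r < a and comparing with any such
-- k a + t, n is a gap exactly when 4 q < r, or when r = 1, q ≥ 1 and 4 q ≤ a + 4 (for larger q,
-- q a + 1 = (q - 1) a + (a + 1) is reachable). The gaps therefore form the arithmetic
-- progressions q a + r, 4 q < r < a, together with the numbers q a + 1, 1 ≤ q ≤ ⌊(a + 4) / 4⌋;
-- summing them gives a polynomial in a, ⌊(a + 2) / 4⌋ and ⌊(a + 4) / 4⌋, which becomes the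
-- stated formula in each residue class of a modulo 4.
module Submission where

open import Defs
open import Data.Nat
  using (ℕ; zero; suc; _+_; _*_; _∸_; _≤_; _<_; _/_; _%_; _≤?_; _<?_; _≟_; z≤n; s≤s; z<s; NonZero)
open import Data.Nat.Properties
open import Data.Nat.DivMod
  using (m≡m%n+[m/n]*n; m%n<n; m/n*n≤m; m*n/n≡m; /-monoˡ-≤; +-distrib-/-∣ʳ)
open import Data.Nat.Divisibility using (n∣m*n)
open import Data.Nat.ListAction using (sum)
open import Data.Nat.ListAction.Properties using (sum-++)
open import Data.Nat.Tactic.RingSolver using (solve-∀)
open import Data.Fin using (Fin; zero; suc)
open import Data.Vec using (Vec; []; _∷_; lookup; replicate; zipWith)
open import Data.List using (List; []; _++_; applyDownFrom)
open import Data.List.Membership.Propositional using (_∈_)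
open import Data.List.Membership.Propositional.Properties
  using (∈-++⁺ˡ; ∈-++⁺ʳ; ∈-++⁻; ∈-applyDownFrom⁺; ∈-applyDownFrom⁻)
open import Data.List.Relation.Unary.AllPairs using ([])
open import Data.List.Relation.Unary.Unique.Propositional using (Unique)
open import Data.List.Relation.Unary.Unique.Propositional.Properties using (++⁺; applyDownFrom⁺₁)
open import Data.Product using (Σ; ∃; ∃₂; _×_; _,_; proj₁)
open import Data.Sum using (_⊎_; inj₁; inj₂)
open import Data.Empty using (⊥-elim)
open import Function using (_∘_)
open import Function.Bundles using (_⇔_; mk⇔)
import Function.Properties.Equivalence as ⇔
open import Relation.Nullary using (¬_; Dec; yes; no)
open import Relation.Nullary.Decidable using (_×-dec_; _⊎-dec_; decidable-stable)
open import Relation.Binary.PropositionalEquality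
  using (_≡_; _≢_; refl; sym; trans; cong; cong₂; subst; module ≡-Reasoning)

[m+n]*o+p≡m*o+[n*o+p] : ∀ m n o p → (m + n) * o + p ≡ m * o + (n * o + p)
[m+n]*o+p≡m*o+[n*o+p] m n o p =
  trans (cong (_+ p) (*-distribʳ-+ o m n)) (+-assoc (m * o) (n * o) p)

*+≡*+⇒ : ∀ {a k t q r} → r < a → k * a + t ≡ q * a + r →
  ∃ λ d → q ≡ d + k × t ≡ d * a + r
*+≡*+⇒ {a} {k} {t} {q} {r} r<a eq with k ≤? q
... | yes k≤q with d , refl ← m≤n⇒∃[o]m+o≡n k≤q =
  d , +-comm k d , +-cancelˡ-≡ (k * a) t (d * a + r) (trans eq ([m+n]*o+p≡m*o+[n*o+p] k d a r))
... | no k≰q with d , refl ← m≤n⇒∃[o]m+o≡n (≰⇒> k≰q) =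
  ⊥-elim (<⇒≱ r<a (subst (a ≤_) r≡ (≤-trans (m≤m+n a (d * a)) (m≤m+n (a + d * a) t))))
  where
  r≡ : (a + d * a) + t ≡ r
  r≡ = +-cancelˡ-≡ (q * a) _ _ (begin
    q * a + (suc d * a + t) ≡⟨ [m+n]*o+p≡m*o+[n*o+p] q (suc d) a t ⟨
    (q + suc d) * a + t     ≡⟨ cong (λ k → k * a + t) (+-suc q d) ⟩
    (suc q + d) * a + t     ≡⟨ eq ⟩
    q * a + r               ∎)
    where open ≡-Reasoning

*+-injective : ∀ {a q r q′ r′} → r < a → r′ < a → q * a + r ≡ q′ * a + r′ → q ≡ q′ × r ≡ r′
*+-injective r<a r′<a eq with *+≡*+⇒ r′<a eq
... | zero  , q′≡q , r≡r′ = sym q′≡q , r≡r′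
... | suc d , _    , refl = ⊥-elim (<⇒≱ r<a (≤-trans (m≤m+n _ _) (m≤m+n _ _)))

division : ∀ {a} n → 0 < a → ∃₂ λ q r → r < a × q * a + r ≡ n
division {suc a} n _ = n / suc a , n % suc a , m%n<n n (suc a) ,
  trans (+-comm (n / suc a * suc a) (n % suc a)) (sym (m≡m%n+[m/n]*n n (suc a)))

<∸⇒+< : ∀ m {n o} → n < o ∸ m → m + n < o
<∸⇒+< zero              n<o   = n<o
<∸⇒+< (suc m) {o = zero}  ()
<∸⇒+< (suc m) {o = suc o} n<o∸m = s≤s (<∸⇒+< m n<o∸m)

+<⇒<∸ : ∀ m {n o} → m + n < o → n < o ∸ m
+<⇒<∸ zero    m+n<o       = m+n<o
+<⇒<∸ (suc m) (s≤s m+n<o) = +<⇒<∸ m m+n<o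

*≤⇒≤/ : ∀ d {m n} .{{_ : NonZero d}} → d * m ≤ n → m ≤ n / d
*≤⇒≤/ d {m} {n} dm≤n =
  subst (_≤ n / d) (m*n/n≡m m d) (/-monoˡ-≤ d (subst (_≤ n) (*-comm d m) dm≤n))

≤/⇒*≤ : ∀ d {m n} .{{_ : NonZero d}} → m ≤ n / d → d * m ≤ n
≤/⇒*≤ d {m} {n} m≤n/d =
  ≤-trans (*-monoʳ-≤ d m≤n/d) (subst (_≤ n) (*-comm (n / d) d) (m/n*n≤m n d))

[m+n*d]/d≡m/d+n : ∀ m n d .{{_ : NonZero d}} → (m + n * d) / d ≡ m / d + n
[m+n*d]/d≡m/d+n m n d = trans (+-distrib-/-∣ʳ m (n∣m*n n)) (cong (m / d +_) (m*n/n≡m n d))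

lincomb-replicate-0 : ∀ {m} (as : Vec ℕ m) → lincomb (replicate m 0) as ≡ 0
lincomb-replicate-0 []       = refl
lincomb-replicate-0 (a ∷ as) = lincomb-replicate-0 as

lincomb-zipWith-+ : ∀ {m} (xs ys as : Vec ℕ m) →
  lincomb (zipWith _+_ xs ys) as ≡ lincomb xs as + lincomb ys as
lincomb-zipWith-+ []       []       []       = refl
lincomb-zipWith-+ (x ∷ xs) (y ∷ ys) (a ∷ as) = begin
  (x + y) * a + lincomb (zipWith _+_ xs ys) as
    ≡⟨ cong₂ _+_ (*-distribʳ-+ a x y) (lincomb-zipWith-+ xs ys as) ⟩
  (x * a + y * a) + (lincomb xs as + lincomb ys as)
    ≡⟨ +-interchange (x * a) (y * a) (lincomb xs as) (lincomb ys as) ⟩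
  (x * a + lincomb xs as) + (y * a + lincomb ys as) ∎
  where
  open ≡-Reasoning
  +-interchange : ∀ p q r s → (p + q) + (r + s) ≡ (p + r) + (q + s)
  +-interchange = solve-∀

representable-+ : ∀ {m} {as : Vec ℕ m} {x y} →
  Representable as x → Representable as y → Representable as (x + y)
representable-+ {as = as} (xs , refl) (ys , refl) =
  zipWith _+_ xs ys , lincomb-zipWith-+ xs ys as

representable-lookup : ∀ {m} (as : Vec ℕ m) (i : Fin m) → Representable as (lookup as i)
representable-lookup (a ∷ as) zero = 1 ∷ replicate _ 0 , (begin
  1 * a + lincomb (replicate _ 0) as ≡⟨ cong₂ _+_ (*-identityˡ a) (lincomb-replicate-0 as) ⟩
  a + 0                              ≡⟨ +-identityʳ a ⟩
  a                                  ∎)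
  where open ≡-Reasoning
representable-lookup (a ∷ as) (suc i) with xs , eq ← representable-lookup as i = 0 ∷ xs , eq

gens : ℕ → Vec ℕ 4
gens a = a ∷ a + 2 ∷ a + 3 ∷ a + 4 ∷ []

lincomb-gens : ∀ a x₀ x₁ x₂ x₃ → lincomb (x₀ ∷ x₁ ∷ x₂ ∷ x₃ ∷ []) (gens a) ≡
  (x₀ + x₁ + x₂ + x₃) * a + (2 * x₁ + 3 * x₂ + 4 * x₃)
lincomb-gens = unfolded
  where
  unfolded : ∀ a x₀ x₁ x₂ x₃ → x₀ * a + (x₁ * (a + 2) + (x₂ * (a + 3) + (x₃ * (a + 4) + 0))) ≡
    (x₀ + x₁ + x₂ + x₃) * a + (2 * x₁ + 3 * x₂ + 4 * x₃)
  unfolded = solve-∀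

-- k a + t is a sum of k generators a + dᵢ, dᵢ ∈ {0, 2, 3, 4}, exactly when t is attainable.
Attainable : ℕ → ℕ → Set
Attainable k t = t ≤ 4 * k × t ≢ 1

attainable⇒representable : ∀ a k t → Attainable k t → Representable (gens a) (k * a + t)
attainable⇒representable a zero    zero    _         = 0 ∷ 0 ∷ 0 ∷ 0 ∷ [] , refl
attainable⇒representable a (suc k) t       (t≤ , t≢1) with t ≤? 4 * k
... | yes t≤4k = subst (Representable (gens a)) (sym (+-assoc a (k * a) t))
                   (representable-+ (representable-lookup (gens a) zero)
                                    (attainable⇒representable a k t (t≤4k , t≢1)))
... | no t≰4k = peel-offset t t≤′ t≰4k t≢1
  where
  t≤′ : t ≤ 4 + 4 * k
  t≤′ = subst (t ≤_) (*-suc 4 k) t≤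
  add-generator : ∀ d t′ → Representable (gens a) (a + d) → Attainable k t′ →
    Representable (gens a) (suc k * a + (d + t′))
  add-generator d t′ g att = subst (Representable (gens a)) (rearrange a d k t′)
    (representable-+ g (attainable⇒representable a k t′ att))
    where
    rearrange : ∀ a d k t → (a + d) + (k * a + t) ≡ suc k * a + (d + t)
    rearrange = solve-∀
  generator : (i : Fin 4) → Representable (gens a) (lookup (gens a) i)
  generator = representable-lookup (gens a)
  peel-offset : ∀ t → t ≤ 4 + 4 * k → ¬ t ≤ 4 * k → t ≢ 1 →
    Representable (gens a) (suc k * a + t)
  peel-offset 0 _ t≰4k _ = ⊥-elim (t≰4k z≤n)
  peel-offset 1 _ _ t≢1  = ⊥-elim (t≢1 refl)
  peel-offset 2 _ _ _    = add-generator 2 0 (generator (suc zero)) (z≤n , λ ())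
  peel-offset 3 _ _ _    = add-generator 3 0 (generator (suc (suc zero))) (z≤n , λ ())
  peel-offset 4 _ _ _    = add-generator 4 0 (generator (suc (suc (suc zero)))) (z≤n , λ ())
  -- peeling a + 4 here would leave the unattainable offset 1
  peel-offset 5 t≤ _ _   = add-generator 2 3 (generator (suc zero)) (3≤4k , λ ())
    where
    3≤4k : 3 ≤ 4 * k
    3≤4k = ≤-trans (n≤1+n 3) (*-monoʳ-≤ 4 (*-cancelˡ-< 4 0 k (+-cancelˡ-≤ 4 1 (4 * k) t≤)))
  peel-offset (suc (suc (suc (suc (suc (suc t′)))))) t≤ _ _ =
    add-generator 4 (2 + t′) (generator (suc (suc (suc zero)))) (+-cancelˡ-≤ 4 _ _ t≤ , λ ())

offsets≢1 : ∀ x₁ x₂ x₃ → 2 * x₁ + 3 * x₂ + 4 * x₃ ≢ 1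
offsets≢1 zero zero zero ()
offsets≢1 (suc x₁) x₂ x₃ eq with trans (cong (λ z → z + 3 * x₂ + 4 * x₃) (sym (*-suc 2 x₁))) eq
... | ()
offsets≢1 zero (suc x₂) x₃ eq with trans (cong (_+ 4 * x₃) (sym (*-suc 3 x₂))) eq
... | ()
offsets≢1 zero zero (suc x₃) eq with trans (sym (*-suc 4 x₃)) eq
... | ()

representable⇒attainable : ∀ {a n} → Representable (gens a) n →
  ∃₂ λ k t → Attainable k t × k * a + t ≡ n
representable⇒attainable {a} (x₀ ∷ x₁ ∷ x₂ ∷ x₃ ∷ [] , refl) =
  k , t , (t≤4k , offsets≢1 x₁ x₂ x₃) , sym (lincomb-gens a x₀ x₁ x₂ x₃)
  where
  k t : ℕ
  k = x₀ + x₁ + x₂ + x₃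
  t = 2 * x₁ + 3 * x₂ + 4 * x₃
  slack : ∀ x₀ x₁ x₂ x₃ →
    2 * x₁ + 3 * x₂ + 4 * x₃ + (4 * x₀ + 2 * x₁ + x₂) ≡ 4 * (x₀ + x₁ + x₂ + x₃)
  slack = solve-∀
  t≤4k : t ≤ 4 * k
  t≤4k = subst (t ≤_) (slack x₀ x₁ x₂ x₃) (m≤m+n t (4 * x₀ + 2 * x₁ + x₂))

GapPosition : ℕ → ℕ → ℕ → Set
GapPosition a q r = 4 * q < r ⊎ (r ≡ 1 × 0 < q × 4 * q ≤ 4 + a)

gapPosition? : ∀ a q r → Dec (GapPosition a q r)
gapPosition? a q r = 4 * q <? r ⊎-dec r ≟ 1 ×-dec 0 <? q ×-dec 4 * q ≤? 4 + a

gapPosition⇒¬representable : ∀ {a q r} → r < a → GapPosition a q r →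
  ¬ Representable (gens a) (q * a + r)
gapPosition⇒¬representable {a} {q} {r} r<a gap R
  with k , t , (t≤4k , t≢1) , eq ← representable⇒attainable R
  with *+≡*+⇒ {a} {k} {t} {q} {r} r<a eq | gap
... | zero  , refl , refl | inj₁ 4q<r      = <⇒≱ 4q<r t≤4k
... | zero  , refl , refl | inj₂ (r≡1 , _) = t≢1 r≡1
... | suc d , refl , refl | inj₁ 4q<r      =
  <⇒≱ 4q<r (≤-trans (m≤n+m r _) (≤-trans t≤4k (*-monoʳ-≤ 4 (m≤n+m k (suc d)))))
... | suc d , refl , refl | inj₂ (refl , _ , 4q≤4+a) =
  <⇒≱ (≤-<-trans (m≤m+n a _) (m<m+n _ z<s)) (≤-trans t≤4k 4k≤a)
  where
  4k≤a : 4 * k ≤ a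
  4k≤a = +-cancelˡ-≤ 4 (4 * k) a (begin
    4 + 4 * k         ≤⟨ +-monoʳ-≤ 4 (*-monoʳ-≤ 4 (m≤n+m k d)) ⟩
    4 + 4 * (d + k)   ≡⟨ *-suc 4 (d + k) ⟨
    4 * suc (d + k)   ≤⟨ 4q≤4+a ⟩
    4 + a             ∎)
    where open ≤-Reasoning

¬gapPosition⇒representable : ∀ {a} q r → 0 < a → ¬ GapPosition a q r →
  Representable (gens a) (q * a + r)
¬gapPosition⇒representable q r 0<a ¬gap with r ≟ 1
... | no r≢1 = attainable⇒representable _ q r (≮⇒≥ (¬gap ∘ inj₁) , r≢1)
¬gapPosition⇒representable zero    _ _ ¬gap | yes refl = ⊥-elim (¬gap (inj₁ z<s))
¬gapPosition⇒representable {a} (suc q) _ 0<a ¬gap | yes refl with 4 * suc q ≤? 4 + a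
... | yes 4q≤4+a = ⊥-elim (¬gap (inj₂ (refl , z<s , 4q≤4+a)))
... | no 4q≰4+a = subst (Representable (gens a)) (shift q a)
                    (attainable⇒representable a q (suc a) (1+a≤4q , 1+a≢1))
  where
  shift : ∀ q a → q * a + suc a ≡ suc q * a + 1
  shift = solve-∀
  1+a≤4q : suc a ≤ 4 * q
  1+a≤4q = +-cancelˡ-≤ 4 (suc a) (4 * q) (subst (4 + a <_) (*-suc 4 q) (≰⇒> 4q≰4+a))
  1+a≢1 : suc a ≢ 1
  1+a≢1 eq = <-irrefl (sym (suc-injective eq)) 0<a

InGapPosition : ℕ → ℕ → Set
InGapPosition a n = ∃₂ λ q r → r < a × GapPosition a q r × q * a + r ≡ n

gap⇔inGapPosition : ∀ {a n} → 0 < a → Gap (gens a) n ⇔ InGapPosition a n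
gap⇔inGapPosition {a} {n} 0<a = mk⇔ to from
  where
  to : Gap (gens a) n → InGapPosition a n
  to (_ , ¬R) with q , r , r<a , refl ← division n 0<a =
    q , r , r<a ,
    decidable-stable (gapPosition? a q r) (¬R ∘ ¬gapPosition⇒representable q r 0<a) , refl
  from : InGapPosition a n → Gap (gens a) n
  from (q , r , r<a , gap , refl) =
    <-≤-trans (0<r gap) (m≤n+m r (q * a)) , gapPosition⇒¬representable r<a gap
    where
    0<r : GapPosition a q r → 0 < r
    0<r (inj₁ 4q<r)       = ≤-<-trans z≤n 4q<r
    0<r (inj₂ (refl , _)) = z<s

interval : ℕ → ℕ → List ℕ
interval s l = applyDownFrom (s +_) l

interval-unique : ∀ s l → Unique (interval s l)
interval-unique s l =
  applyDownFrom⁺₁ (s +_) l (λ j<i _ eq → <⇒≢ j<i (sym (+-cancelˡ-≡ s _ _ eq)))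

gapBlock : ℕ → ℕ → List ℕ
gapBlock a q = interval (q * a + suc (4 * q)) (a ∸ suc (4 * q))

gapBlocks : ℕ → ℕ → List ℕ
gapBlocks a zero    = []
gapBlocks a (suc n) = gapBlock a n ++ gapBlocks a n

multiplesPlusOne : ℕ → ℕ → List ℕ
multiplesPlusOne a e = applyDownFrom (λ i → suc i * a + 1) e

-- The quotients q with a nonempty block 4 q < r < a are those with q < (2 + a) / 4.
gapList : ℕ → List ℕ
gapList a = gapBlocks a ((2 + a) / 4) ++ multiplesPlusOne a ((4 + a) / 4)

∈-gapBlock⁻ : ∀ a q {x} → x ∈ gapBlock a q → ∃ λ r → 4 * q < r × r < a × q * a + r ≡ x
∈-gapBlock⁻ a q x∈ with i , i< , refl ← ∈-applyDownFrom⁻ _ x∈ =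
  suc (4 * q) + i , s≤s (m≤m+n (4 * q) i) , <∸⇒+< (suc (4 * q)) i< ,
  sym (+-assoc (q * a) (suc (4 * q)) i)

∈-gapBlock⁺ : ∀ a q {r} → 4 * q < r → r < a → q * a + r ∈ gapBlock a q
∈-gapBlock⁺ a q 4q<r r<a with i , refl ← m≤n⇒∃[o]m+o≡n 4q<r =
  subst (_∈ gapBlock a q) (+-assoc (q * a) (suc (4 * q)) i)
    (∈-applyDownFrom⁺ _ (+<⇒<∸ (suc (4 * q)) r<a))

∈-gapBlocks⁻ : ∀ a n {x} → x ∈ gapBlocks a n →
  ∃₂ λ q r → q < n × 4 * q < r × r < a × q * a + r ≡ x
∈-gapBlocks⁻ a (suc n) x∈ with ∈-++⁻ (gapBlock a n) x∈
... | inj₁ x∈block with r , 4q<r , r<a , eq ← ∈-gapBlock⁻ a n x∈block =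
  n , r , ≤-refl , 4q<r , r<a , eq
... | inj₂ x∈blocks with q , r , q<n , rest ← ∈-gapBlocks⁻ a n x∈blocks =
  q , r , m<n⇒m<1+n q<n , rest

∈-gapBlocks⁺ : ∀ a n {q r} → q < n → 4 * q < r → r < a → q * a + r ∈ gapBlocks a n
∈-gapBlocks⁺ a (suc n) q<1+n 4q<r r<a with m<1+n⇒m<n∨m≡n q<1+n
... | inj₂ refl = ∈-++⁺ˡ (∈-gapBlock⁺ a n 4q<r r<a)
... | inj₁ q<n  = ∈-++⁺ʳ (gapBlock a n) (∈-gapBlocks⁺ a n q<n 4q<r r<a)

gapBlocks-unique : ∀ a n → Unique (gapBlocks a n)
gapBlocks-unique a zero    = []
gapBlocks-unique a (suc n) = ++⁺ (interval-unique _ _) (gapBlocks-unique a n) disjoint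
  where
  disjoint : ∀ {x} → ¬ (x ∈ gapBlock a n × x ∈ gapBlocks a n)
  disjoint (x∈block , x∈blocks)
    with _ , _ , r<a , eq ← ∈-gapBlock⁻ a n x∈block
       | q , _ , q<n , _ , r′<a , eq′ ← ∈-gapBlocks⁻ a n x∈blocks
    = <-irrefl (sym (proj₁ (*+-injective r<a r′<a (trans eq (sym eq′))))) q<n

multiplesPlusOne-unique : ∀ {a} → 1 < a → ∀ e → Unique (multiplesPlusOne a e)
multiplesPlusOne-unique 1<a e = applyDownFrom⁺₁ _ e
  (λ j<i _ eq → <⇒≢ j<i (sym (suc-injective (proj₁ (*+-injective 1<a 1<a eq)))))

gapList-unique : ∀ {a} → 1 < a → Unique (gapList a)
gapList-unique {a} 1<a = ++⁺ (gapBlocks-unique a n) (multiplesPlusOne-unique 1<a e) disjoint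
  where
  n e : ℕ
  n = (2 + a) / 4
  e = (4 + a) / 4
  disjoint : ∀ {x} → ¬ (x ∈ gapBlocks a n × x ∈ multiplesPlusOne a e)
  disjoint (x∈blocks , x∈multiples)
    with q , r , _ , 4q<r , r<a , eq ← ∈-gapBlocks⁻ a n x∈blocks
       | i , _ , eq′ ← ∈-applyDownFrom⁻ (λ i → suc i * a + 1) x∈multiples
    with *+-injective {q = q} {q′ = suc i} r<a 1<a (trans eq eq′)
  ... | refl , refl with 4q<r
  ...                | s≤s ()

∈-gapList⇔ : ∀ {a x} → 1 < a → x ∈ gapList a ⇔ InGapPosition a x
∈-gapList⇔ {a} {x} 1<a = mk⇔ to from
  where
  n : ℕ
  n = (2 + a) / 4
  to : x ∈ gapList a → InGapPosition a x
  to x∈ with ∈-++⁻ (gapBlocks a n) x∈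
  ... | inj₁ x∈blocks with q , r , _ , 4q<r , r<a , eq ← ∈-gapBlocks⁻ a n x∈blocks =
    q , r , r<a , inj₁ 4q<r , eq
  ... | inj₂ x∈multiples with i , i<e , refl ← ∈-applyDownFrom⁻ (λ i → suc i * a + 1) x∈multiples =
    suc i , 1 , 1<a , inj₂ (refl , z<s , ≤/⇒*≤ 4 i<e) , refl
  from : InGapPosition a x → x ∈ gapList a
  from (q , r , r<a , inj₁ 4q<r , refl) = ∈-++⁺ˡ (∈-gapBlocks⁺ a n (*≤⇒≤/ 4 4[1+q]≤2+a) 4q<r r<a)
    where
    4[1+q]≤2+a : 4 * suc q ≤ 2 + a
    4[1+q]≤2+a = subst (_≤ 2 + a) (sym (*-suc 4 q)) (+-monoʳ-≤ 2 (≤-trans (s≤s 4q<r) r<a))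
  from (suc i , _ , _ , inj₂ (refl , _ , 4q≤4+a) , refl) =
    ∈-++⁺ʳ (gapBlocks a n) (∈-applyDownFrom⁺ (λ i → suc i * a + 1) (*≤⇒≤/ 4 4q≤4+a))

gapList-isSylvesterSum : ∀ {a} → 2 ≤ a → IsSylvesterSum (gens a) (sum (gapList a))
gapList-isSylvesterSum {a} 2≤a =
  gapList a , gapList-unique 2≤a ,
  (λ _ → ⇔.trans (∈-gapList⇔ 2≤a) (⇔.sym (gap⇔inGapPosition (≤-trans (s≤s z≤n) 2≤a)))) , refl

sum-interval : ∀ s l → 2 * sum (interval s l) + l ≡ l * (2 * s + l)
sum-interval s zero    = refl
sum-interval s (suc l) = begin
  2 * (s + l + S) + suc l               ≡⟨ regroup s l S ⟩
  (2 * S + l) + (2 * s + 2 * l + 1)     ≡⟨ cong (_+ (2 * s + 2 * l + 1)) (sum-interval s l) ⟩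
  l * (2 * s + l) + (2 * s + 2 * l + 1) ≡⟨ expand s l ⟩
  suc l * (2 * s + suc l)               ∎
  where
  open ≡-Reasoning
  S : ℕ
  S = sum (interval s l)
  regroup : ∀ s l S → 2 * (s + l + S) + suc l ≡ (2 * S + l) + (2 * s + 2 * l + 1)
  regroup = solve-∀
  expand : ∀ s l → l * (2 * s + l) + (2 * s + 2 * l + 1) ≡ suc l * (2 * s + suc l)
  expand = solve-∀

-- The bound keeps every block length a ∸ suc (4 * q), q < n, from being truncated.
sum-gapBlocks : ∀ a n → 4 * n ≤ 3 + a →
  6 * sum (gapBlocks a n) + 2 * n * (4 * n * n * (a + 2) + 2 * a + 1) ≡
  3 * n * n * (a * a + 3 * a + 6)
sum-gapBlocks a zero    _          = refl
sum-gapBlocks a (suc n) 4[1+n]≤3+a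
  with l , refl ← m≤n⇒∃[o]m+o≡n
                    (+-cancelˡ-≤ 3 (suc (4 * n)) a (subst (_≤ 3 + a) (*-suc 4 n) 4[1+n]≤3+a)) =
  +-cancelʳ-≡ (3 * l) _ _ (begin
    6 * sum (gapBlock a n ++ gapBlocks a n) + X (suc n) + 3 * l
      ≡⟨ cong (λ s → 6 * s + X (suc n) + 3 * l) (sum-++ (gapBlock a n) (gapBlocks a n)) ⟩
    6 * (B + S) + X (suc n) + 3 * l
      ≡⟨ regroup a n B S l ⟩
    3 * (2 * B + l) + (6 * S + X n) + D
      ≡⟨ cong₂ (λ u v → 3 * u + v + D) block-sum (sum-gapBlocks a n 4n≤3+a) ⟩
    3 * (l * (2 * s + l)) + Y n + D
      ≡⟨ close n l ⟩
    Y (suc n) + 3 * l ∎)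
  where
  open ≡-Reasoning
  X Y : ℕ → ℕ
  X n = 2 * n * (4 * n * n * (a + 2) + 2 * a + 1)
  Y n = 3 * n * n * (a * a + 3 * a + 6)
  D s B S : ℕ
  D = 8 * (a + 2) * (3 * n * n + 3 * n + 1) + 2 * (2 * a + 1)
  s = n * a + suc (4 * n)
  B = sum (gapBlock a n)
  S = sum (gapBlocks a n)
  4n≤3+a : 4 * n ≤ 3 + a
  4n≤3+a = ≤-trans (*-monoʳ-≤ 4 (n≤1+n n)) 4[1+n]≤3+a
  block-sum : 2 * B + l ≡ l * (2 * s + l)
  block-sum = subst (λ k → 2 * B + k ≡ k * (2 * s + k)) (m+n∸m≡n (suc (4 * n)) l)
                (sum-interval s (a ∸ suc (4 * n)))
  regroup : ∀ a n B S l →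
    6 * (B + S) + 2 * suc n * (4 * suc n * suc n * (a + 2) + 2 * a + 1) + 3 * l ≡
    3 * (2 * B + l) + (6 * S + 2 * n * (4 * n * n * (a + 2) + 2 * a + 1)) +
    (8 * (a + 2) * (3 * n * n + 3 * n + 1) + 2 * (2 * a + 1))
  regroup = solve-∀
  close : ∀ n l → let a = suc (4 * n) + l in
    3 * (l * (2 * (n * a + suc (4 * n)) + l)) + 3 * n * n * (a * a + 3 * a + 6) +
    (8 * (a + 2) * (3 * n * n + 3 * n + 1) + 2 * (2 * a + 1)) ≡
    3 * suc n * suc n * (a * a + 3 * a + 6) + 3 * l
  close = solve-∀

sum-multiplesPlusOne : ∀ a e → 2 * sum (multiplesPlusOne a e) ≡ e * (a * suc e + 2)
sum-multiplesPlusOne a zero    = refl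
sum-multiplesPlusOne a (suc e) = begin
  2 * (suc e * a + 1 + sum (multiplesPlusOne a e))
    ≡⟨ *-distribˡ-+ 2 (suc e * a + 1) _ ⟩
  2 * (suc e * a + 1) + 2 * sum (multiplesPlusOne a e)
    ≡⟨ cong (2 * (suc e * a + 1) +_) (sum-multiplesPlusOne a e) ⟩
  2 * (suc e * a + 1) + e * (a * suc e + 2)
    ≡⟨ expand a e ⟩
  suc e * (a * suc (suc e) + 2) ∎
  where
  open ≡-Reasoning
  expand : ∀ a e → 2 * (suc e * a + 1) + e * (a * suc e + 2) ≡ suc e * (a * suc (suc e) + 2)
  expand = solve-∀

sum-gapList : ∀ a {n e} → (2 + a) / 4 ≡ n → (4 + a) / 4 ≡ e →
  96 * sum (gapList a) +
  16 * (2 * n * (4 * n * n * (a + 2) + 2 * a + 1)) ≡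
  16 * (3 * n * n * (a * a + 3 * a + 6)) + 48 * (e * (a * suc e + 2))
sum-gapList a {n} {e} refl refl = begin
  96 * sum (blocks ++ multiples) + 16 * X
    ≡⟨ cong (λ s → 96 * s + 16 * X) (sum-++ blocks multiples) ⟩
  96 * (sum blocks + sum multiples) + 16 * X
    ≡⟨ regroup (sum blocks) (sum multiples) X ⟩
  16 * (6 * sum blocks + X) + 48 * (2 * sum multiples)
    ≡⟨ cong₂ (λ u v → 16 * u + 48 * v) (sum-gapBlocks a n 4n≤3+a) (sum-multiplesPlusOne a e) ⟩
  16 * (3 * n * n * (a * a + 3 * a + 6)) + 48 * (e * (a * suc e + 2)) ∎
  where
  open ≡-Reasoning
  blocks multiples : List ℕ
  blocks    = gapBlocks a n
  multiples = multiplesPlusOne a e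
  X : ℕ
  X = 2 * n * (4 * n * n * (a + 2) + 2 * a + 1)
  4n≤3+a : 4 * n ≤ 3 + a
  4n≤3+a = m≤n⇒m≤1+n (≤/⇒*≤ 4 ≤-refl)
  regroup : ∀ B M X → 96 * (B + M) + 16 * X ≡ 16 * (6 * B + X) + 48 * (2 * M)
  regroup = solve-∀

96*sum-gapList≡ : ∀ k m {F} → let a = k + m * 4 ; n = (2 + k) / 4 + m ; e = (4 + k) / 4 + m in
  F + 16 * (2 * n * (4 * n * n * (a + 2) + 2 * a + 1)) ≡
  16 * (3 * n * n * (a * a + 3 * a + 6)) + 48 * (e * (a * suc e + 2)) →
  96 * sum (gapList a) ≡ F
96*sum-gapList≡ k m F-identity = +-cancelʳ-≡ _ _ _ (trans
  (sum-gapList (k + m * 4) ([m+n*d]/d≡m/d+n (2 + k) m 4) ([m+n*d]/d≡m/d+n (4 + k) m 4))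
  (sym F-identity))

identity-4m : ∀ m → let a = m * 4 ; n = m ; e = suc m in
  (a + 4) * (a * a * a + 4 * (a * a) + 22 * a + 24) +
  16 * (2 * n * (4 * n * n * (a + 2) + 2 * a + 1)) ≡
  16 * (3 * n * n * (a * a + 3 * a + 6)) + 48 * (e * (a * suc e + 2))
identity-4m = solve-∀

identity-4m+1 : ∀ m → let a = 1 + m * 4 ; n = m ; e = suc m in
  (a + 3) * (a * a * a + 5 * (a * a) + 8 * a + 34) +
  16 * (2 * n * (4 * n * n * (a + 2) + 2 * a + 1)) ≡
  16 * (3 * n * n * (a * a + 3 * a + 6)) + 48 * (e * (a * suc e + 2))
identity-4m+1 = solve-∀

identity-4m+2 : ∀ m → let a = 2 + m * 4 ; n = suc m ; e = suc m in
  (a + 2) * (a * a * a + 6 * (a * a) + 14 * a + 36) +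
  16 * (2 * n * (4 * n * n * (a + 2) + 2 * a + 1)) ≡
  16 * (3 * n * n * (a * a + 3 * a + 6)) + 48 * (e * (a * suc e + 2))
identity-4m+2 = solve-∀

identity-4m+3 : ∀ m → let a = 3 + m * 4 ; n = suc m ; e = suc m in
  (a + 5) * (a * a * a + 3 * (a * a) + 8 * a + 6) +
  16 * (2 * n * (4 * n * n * (a + 2) + 2 * a + 1)) ≡
  16 * (3 * n * n * (a * a + 3 * a + 6)) + 48 * (e * (a * suc e + 2))
identity-4m+3 = solve-∀

corollary1 : (a : ℕ) → 2 ≤ a →
    Σ ℕ λ s → IsSylvesterSum (a ∷ (a + 2) ∷ (a + 3) ∷ (a + 4) ∷ []) s
      × ((a % 4 ≡ 0 → 96 * s ≡ (a + 4) * (a * a * a + 4 * (a * a) + 22 * a + 24))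
      × (a % 4 ≡ 1 → 96 * s ≡ (a + 3) * (a * a * a + 5 * (a * a) + 8 * a + 34))
      × (a % 4 ≡ 2 → 96 * s ≡ (a + 2) * (a * a * a + 6 * (a * a) + 14 * a + 36))
      × (a % 4 ≡ 3 → 96 * s ≡ (a + 5) * (a * a * a + 3 * (a * a) + 8 * a + 6)))
corollary1 a 2≤a with a % 4 | a / 4 | m≡m%n+[m/n]*n a 4 | m%n<n a 4
... | 0 | m | refl | _ = _ , gapList-isSylvesterSum 2≤a ,
  (λ _ → 96*sum-gapList≡ 0 m (identity-4m m)) , (λ ()) , (λ ()) , (λ ())
... | 1 | m | refl | _ = _ , gapList-isSylvesterSum 2≤a ,
  (λ ()) , (λ _ → 96*sum-gapList≡ 1 m (identity-4m+1 m)) , (λ ()) , (λ ())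
... | 2 | m | refl | _ = _ , gapList-isSylvesterSum 2≤a ,
  (λ ()) , (λ ()) , (λ _ → 96*sum-gapList≡ 2 m (identity-4m+2 m)) , (λ ())
... | 3 | m | refl | _ = _ , gapList-isSylvesterSum 2≤a ,
  (λ ()) , (λ ()) , (λ ()) , (λ _ → 96*sum-gapList≡ 3 m (identity-4m+3 m))
... | suc (suc (suc (suc _))) | _ | _ | s≤s (s≤s (s≤s (s≤s ())))
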